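{- Let $S$ be a numerical semigroup with minimal generators $a_1<a_2<\cdots<a_\nu$ (so $\nu\ge2$ is the embedding dimension), multiplicity $\mu=a_1$ and conductor $c$, and suppose $a_2>\frac{c+\mu}{3}$. Let $P=\{a_1,\ldots,a_\nu\}$, $P_1=\{a\in P\setminus\{\mu\}\mid \frac{c+\mu}{3}<a<\frac{c+\mu}{2}\}$, $P_2=\{a\in P\setminus\{\mu\}\mid \frac{c+\mu}{2}\le a<\frac{2}{3}(c+\mu)\}$, and $q_1=|P_1|$, $q_2=|P_2|$. Then: (a) $\mu\le \nu+\frac{q_1(q_1+1)}{2}+q_1q_2$; (b) $\mu\le\frac12\nu(\nu+1)$; (c) $q_1\ge\frac{2\nu-1-\sqrt{(2\nu+1)^2-8\mu}}{2}$.
   Context: A numerical semigroup is a subset $S\subseteq\mathbb{N}$ containing $0$, closed under addition, with $\mathbb{N}\setminus S$ finite. Its conductor $c=c(S)$ is the least integer $x$ with $x+\mathbb{N}\subseteq S$. $S$ has a unique minimal set of generators; its cardinality is the embedding dimension $\nu(S)$ and its least element is the multiplicity $\mu(S)$. -}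

module Defs where

open import Level using (0ℓ)
open import Data.Nat using (ℕ; zero; suc; _+_; _*_; _≤_; _<_; _≤?_; _<?_; _≟_)
open import Data.Nat.Properties using ()
open import Data.Product using (Σ; ∃; _×_; _,_)
open import Data.List using (List; []; _∷_; length; filter)
open import Data.List.Membership.Propositional using (_∈_)
open import Data.List.Relation.Unary.Linked using (Linked)
open import Relation.Unary using (Pred; Decidable)
open import Relation.Nullary using (¬_)
open import Relation.Nullary.Decidable using (_×-dec_; ¬?)
open import Relation.Binary.PropositionalEquality using (_≡_)
open import Function.Bundles using (_⇔_)

record NumericalSemigroup : Set₁ where
  field
    _∈S     : Pred ℕ 0ℓ
    zero∈S  : 0 ∈S
    closed  : ∀ x y → x ∈S → y ∈S → (x + y) ∈S
    cofinite : ∃ λ x → ∀ y → x ≤ y → y ∈S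
open NumericalSemigroup public

Tail⊆ : NumericalSemigroup → ℕ → Set
Tail⊆ S x = ∀ y → x ≤ y → _∈S S y

IsConductor : NumericalSemigroup → ℕ → Set
IsConductor S c = Tail⊆ S c × (∀ x → Tail⊆ S x → c ≤ x)

data Gen (G : List ℕ) : ℕ → Set where
  gen-zero : Gen G 0
  gen-add  : ∀ {a x} → a ∈ G → Gen G x → Gen G (a + x)

Generates : List ℕ → NumericalSemigroup → Set
Generates G S = ∀ x → (_∈S S x ⇔ Gen G x)

IsMinimalGeneratorList : NumericalSemigroup → List ℕ → Set
IsMinimalGeneratorList S gens =
  Linked _<_ gens ×
  Generates gens S ×
  (∀ (G' : List ℕ) → (∀ x → x ∈ G' → x ∈ gens) → Generates G' S →
     ∀ x → x ∈ gens → x ∈ G')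

-- P₁ membership (with s = c + μ):  a ≠ μ ,  s/3 < a < s/2
inP₁? : (μ s : ℕ) → Decidable (λ a → ¬ (a ≡ μ) × (s < 3 * a) × (2 * a < s))
inP₁? μ s a = ¬? (a ≟ μ) ×-dec ((s <? 3 * a) ×-dec (2 * a <? s))

-- P₂ membership:  a ≠ μ ,  s/2 ≤ a < 2s/3
inP₂? : (μ s : ℕ) → Decidable (λ a → ¬ (a ≡ μ) × (s ≤ 2 * a) × (3 * a < 2 * s))
inP₂? μ s a = ¬? (a ≟ μ) ×-dec ((s ≤? 2 * a) ×-dec (3 * a <? 2 * s))

q₁ : ℕ → ℕ → List ℕ → ℕ
q₁ μ s P = length (filter (inP₁? μ s) P)

q₂ : ℕ → ℕ → List ℕ → ℕ
q₂ μ s P = length (filter (inP₂? μ s) P)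

module Submission where

-- Every nonzero residue class modulo μ contains an element of S in
-- the window [c, s).  Removing copies of μ from a factorisation of such an
-- element leaves a nonzero sum z < s of generators a ≠ μ; as each of these
-- exceeds s/3, z is a single generator or a sum a + b with a ≤ b.  Then
-- 2a < s puts a in P₁, and b lies in P₁ (if 2b < s) or in P₂ (since
-- 3b < 2s).  So the μ - 1 nonzero residues are all represented in the list
--   T = (generators ≠ μ) ++ (pair sums of P₁) ++ (sums P₁ + P₂),
-- of length (ν - 1) + q₁(q₁+1)/2 + q₁q₂, which gives (a).  Parts (b) and (c)
-- are pure arithmetic consequences of (a) and q₁ + q₂ ≤ ν - 1.

open import Defs
open import Data.Nat using (ℕ; _+_; _*_; _≤_; _<_)
open import Data.Integer using (ℤ; +_) renaming (_+_ to _+ℤ_; _-_ to _-ℤ_; _*_ to _*ℤ_; _≤_ to _≤ℤ_)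
open import Data.List using (List; _∷_; length)
open import Data.Product using (_×_)
open import Data.Sum using (_⊎_)

open import Data.Nat using (zero; suc; _∸_; _%_; _/_; _<?_; z≤n; s≤s; NonZero)
open import Data.Nat.Properties
open import Data.Nat.DivMod using (m≡m%n+[m/n]*n; m%n<n; [m+kn]%n≡m%n; m<n⇒m%n≡m)
open import Data.Nat.Tactic.RingSolver using (solve-∀)
open import Data.Integer using (+≤+)
import Data.Integer.Properties as ℤ
open import Data.List using ([]; map; _++_; filter; lookup; cartesianProductWith)
open import Data.List.Properties using (length-++; length-map; filter-reject)
open import Data.List.Membership.Propositional using (_∈_)
open import Data.List.Membership.Propositional.Properties
  using (∈-map⁺; ∈-++⁺ˡ; ∈-++⁺ʳ; ∈-filter⁺; ∈-cartesianProductWith⁺)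
open import Data.List.Relation.Unary.Any using (here; there; index)
open import Data.List.Relation.Unary.Any.Properties using (lookup-index)
open import Data.List.Relation.Unary.All as All using ()
open import Data.List.Relation.Unary.AllPairs using (_∷_)
open import Data.List.Relation.Unary.Linked using (Linked)
open import Data.List.Relation.Unary.Linked.Properties using (Linked⇒AllPairs)
open import Data.Fin using (Fin; toℕ)
open import Data.Fin.Properties using (injective⇒≤; toℕ-injective; toℕ<n)
open import Data.Product using (∃-syntax; _,_; proj₁; proj₂)
open import Data.Sum using (inj₁; inj₂)
open import Data.Empty using (⊥-elim)
open import Relation.Nullary using (¬_; yes; no)
open import Relation.Unary using (Pred; Decidable)
open import Relation.Binary.PropositionalEquality
open import Function.Bundles using (Equivalence)

pairSums : List ℕ → List ℕ
pairSums []      = []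
pairSums (a ∷ l) = map (_+_ a) (a ∷ l) ++ pairSums l

length-pairSums : ∀ l → 2 * length (pairSums l) ≡ length l * (length l + 1)
length-pairSums []      = refl
length-pairSums (a ∷ l) = begin
  2 * length (map (_+_ a) (a ∷ l) ++ pairSums l)
    ≡⟨ cong (2 *_) (length-++ (map (_+_ a) (a ∷ l))) ⟩
  2 * (length (map (_+_ a) (a ∷ l)) + length (pairSums l))
    ≡⟨ cong (λ m → 2 * (m + length (pairSums l))) (length-map (_+_ a) (a ∷ l)) ⟩
  2 * (suc n + length (pairSums l))
    ≡⟨ *-distribˡ-+ 2 (suc n) (length (pairSums l)) ⟩
  2 * suc n + 2 * length (pairSums l)
    ≡⟨ cong (λ t → 2 * suc n + t) (length-pairSums l) ⟩
  2 * suc n + n * (n + 1)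
    ≡⟨ triangle-step n ⟩
  suc n * (suc n + 1) ∎
  where
  open ≡-Reasoning
  n = length l
  triangle-step : ∀ n → 2 * suc n + n * (n + 1) ≡ suc n * (suc n + 1)
  triangle-step = solve-∀

∈-pairSums : ∀ {x y} l → x ∈ l → y ∈ l → x + y ∈ pairSums l
∈-pairSums (a ∷ l) (here refl) y∈ = ∈-++⁺ˡ (∈-map⁺ (_+_ a) y∈)
∈-pairSums {x} {y} (a ∷ l) (there x∈) (here refl) =
  subst (_∈ pairSums (a ∷ l)) (+-comm y x) (∈-++⁺ˡ (∈-map⁺ (_+_ a) (there x∈)))
∈-pairSums (a ∷ l) (there x∈) (there y∈) = ∈-++⁺ʳ (map (_+_ a) (a ∷ l)) (∈-pairSums l x∈ y∈)

length-cartesianProductWith : ∀ {A B C : Set} (f : A → B → C) xs ys →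
  length (cartesianProductWith f xs ys) ≡ length xs * length ys
length-cartesianProductWith f []       ys = refl
length-cartesianProductWith f (x ∷ xs) ys = begin
  length (map (f x) ys ++ cartesianProductWith f xs ys)
    ≡⟨ length-++ (map (f x) ys) ⟩
  length (map (f x) ys) + length (cartesianProductWith f xs ys)
    ≡⟨ cong₂ _+_ (length-map (f x) ys) (length-cartesianProductWith f xs ys) ⟩
  length ys + length xs * length ys ∎
  where open ≡-Reasoning

length-filter-disjoint : ∀ {p q} {P : Pred ℕ p} {Q : Pred ℕ q}
  (P? : Decidable P) (Q? : Decidable Q) → (∀ {x} → P x → ¬ Q x) →
  ∀ l → length (filter P? l) + length (filter Q? l) ≤ length l
length-filter-disjoint P? Q? disjoint [] = z≤n
length-filter-disjoint P? Q? disjoint (x ∷ l) with P? x | Q? x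
... | yes p | yes q = ⊥-elim (disjoint p q)
... | yes _ | no _  = s≤s (length-filter-disjoint P? Q? disjoint l)
... | no _  | yes _ = subst (_≤ suc (length l)) (sym (+-suc _ _))
                        (s≤s (length-filter-disjoint P? Q? disjoint l))
... | no _  | no _  = m≤n⇒m≤1+n (length-filter-disjoint P? Q? disjoint l)

-- If every nonzero residue modulo m = 1 + m' is the residue of an entry of
-- T, then T has at least m' entries: distinct residues occupy distinct
-- positions of T.
nonzero-residues-bound : ∀ m' (T : List ℕ) →
  (∀ r → 0 < r → r < suc m' → ∃[ y ] (y ∈ T × y % suc m' ≡ r)) →
  m' ≤ length T
nonzero-residues-bound m' T covers = injective⇒≤ position-injective
  where
  witness∈T : (i : Fin m') → ∃[ y ] (y ∈ T × y % suc m' ≡ suc (toℕ i))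
  witness∈T i = covers (suc (toℕ i)) (s≤s z≤n) (s≤s (toℕ<n i))

  position : Fin m' → Fin (length T)
  position i = index (proj₁ (proj₂ (witness∈T i)))

  residue-at : ∀ i → lookup T (position i) % suc m' ≡ suc (toℕ i)
  residue-at i with witness∈T i
  ... | y , y∈T , y%m = subst (λ t → t % suc m' ≡ suc (toℕ i)) (lookup-index y∈T) y%m

  position-injective : ∀ {i j} → position i ≡ position j → i ≡ j
  position-injective {i} {j} same = toℕ-injective (suc-injective (begin
    suc (toℕ i)                ≡⟨ residue-at i ⟨
    lookup T (position i) % suc m' ≡⟨ cong (λ p → lookup T p % suc m') same ⟩
    lookup T (position j) % suc m' ≡⟨ residue-at j ⟩
    suc (toℕ j)                ∎))
    where open ≡-Reasoning

window-representative : ∀ c m .{{_ : NonZero m}} x → c ≤ x →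
  ∃[ y ] (c ≤ y × y < c + m × y % m ≡ x % m)
window-representative c m x c≤x =
  c + t , m≤m+n c t , +-monoʳ-< c (m%n<n (x ∸ c) m) , same-residue
  where
  t = (x ∸ c) % m
  q = (x ∸ c) / m
  same-residue : (c + t) % m ≡ x % m
  same-residue = begin
    (c + t) % m           ≡⟨ [m+kn]%n≡m%n (c + t) q m ⟨
    (c + t + q * m) % m   ≡⟨ cong (_% m) (+-assoc c t (q * m)) ⟩
    (c + (t + q * m)) % m ≡⟨ cong (λ u → (c + u) % m) (m≡m%n+[m/n]*n (x ∸ c) m) ⟨
    (c + (x ∸ c)) % m     ≡⟨ cong (_% m) (m+[n∸m]≡n c≤x) ⟩
    x % m                 ∎
    where open ≡-Reasoning

three-thirds : ∀ {s a b d} → s < 3 * a → s < 3 * b → s < 3 * d → s < a + (b + d)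
three-thirds {s} {a} {b} {d} sa sb sd = *-cancelˡ-< 3 s (a + (b + d)) (begin-strict
  3 * s                   ≡⟨ triple s ⟩
  s + (s + s)             <⟨ +-mono-< sa (+-mono-< sb sd) ⟩
  3 * a + (3 * b + 3 * d) ≡⟨ distrib a b d ⟩
  3 * (a + (b + d))       ∎)
  where
  open ≤-Reasoning
  triple : ∀ s → 3 * s ≡ s + (s + s)
  triple = solve-∀
  distrib : ∀ a b d → 3 * a + (3 * b + 3 * d) ≡ 3 * (a + (b + d))
  distrib = solve-∀

smaller-summand : ∀ {s a b} → a ≤ b → a + b < s → 2 * a < s
smaller-summand {a = a} a≤b a+b<s =
  ≤-<-trans (+-monoʳ-≤ a (≤-trans (≤-reflexive (+-identityʳ a)) a≤b)) a+b<s

other-summand : ∀ {s a b} → s < 3 * a → a + b < s → 3 * b < 2 * s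
other-summand {s} {a} {b} sa a+b<s = +-cancelˡ-< s (3 * b) (2 * s) (begin-strict
  s + 3 * b     <⟨ +-monoˡ-< (3 * b) sa ⟩
  3 * a + 3 * b ≡⟨ *-distribˡ-+ 3 a b ⟨
  3 * (a + b)   <⟨ *-monoʳ-< 3 a+b<s ⟩
  s + 2 * s     ∎)
  where open ≤-Reasoning

increasing-bounds : ∀ {a b l y} → Linked _<_ (a ∷ b ∷ l) → y ∈ b ∷ l → a < y × b ≤ y
increasing-bounds increasing y∈ with Linked⇒AllPairs <-trans increasing
increasing-bounds increasing (here refl) | a<bl ∷ _ = All.lookup a<bl (here refl) , ≤-refl
increasing-bounds increasing (there y∈l) | a<bl ∷ (b<l ∷ _) =
  All.lookup a<bl (there y∈l) , <⇒≤ (All.lookup b<l y∈l)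

split-multiple : ∀ {m G x} → Gen (m ∷ G) x → ∃[ z ] ∃[ k ] (Gen G z × x ≡ z + k * m)
split-multiple gen-zero = 0 , 0 , gen-zero , refl
split-multiple {m} (gen-add (here refl) g) with split-multiple g
... | z , k , gz , refl = z , suc k , gz , +-comm-middle m z (k * m)
  where
  +-comm-middle : ∀ m z w → m + (z + w) ≡ z + (m + w)
  +-comm-middle = solve-∀
split-multiple {m} (gen-add {a} (there a∈G) g) with split-multiple g
... | z , k , gz , refl = a + z , k , gen-add a∈G gz , sym (+-assoc a z (k * m))

data OneOrTwo (G : List ℕ) : ℕ → Set where
  one : ∀ {a} → a ∈ G → OneOrTwo G a
  two : ∀ {a b} → a ∈ G → b ∈ G → a ≤ b → OneOrTwo G (a + b)

two-sorted : ∀ {G a b} → a ∈ G → b ∈ G → OneOrTwo G (a + b)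
two-sorted {a = a} {b} a∈ b∈ with ≤-total a b
... | inj₁ a≤b = two a∈ b∈ a≤b
... | inj₂ b≤a = subst (OneOrTwo _) (+-comm b a) (two b∈ a∈ b≤a)

short-sum : ∀ {s G z} → (∀ {a} → a ∈ G → s < 3 * a) →
  Gen G z → z < s → z ≢ 0 → OneOrTwo G z
short-sum large gen-zero z<s z≢0 = ⊥-elim (z≢0 refl)
short-sum large (gen-add {a} a∈ gen-zero) z<s z≢0 =
  subst (OneOrTwo _) (sym (+-identityʳ a)) (one a∈)
short-sum large (gen-add {a} a∈ (gen-add {b} b∈ gen-zero)) z<s z≢0 =
  subst (λ t → OneOrTwo _ (a + t)) (sym (+-identityʳ b)) (two-sorted a∈ b∈)
short-sum {s} large (gen-add {a} a∈ (gen-add {b} b∈ (gen-add {d} {w} d∈ _))) z<s z≢0 =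
  ⊥-elim (<⇒≱ z<s (begin
    s                 ≤⟨ <⇒≤ (three-thirds {s} {a} {b} {d} (large a∈) (large b∈) (large d∈)) ⟩
    a + (b + d)       ≤⟨ +-monoʳ-≤ a (+-monoʳ-≤ b (m≤m+n d w)) ⟩
    a + (b + (d + w)) ∎))
  where open ≤-Reasoning

module ResidueCovering
  (S : NumericalSemigroup) (c μ' a₂ : ℕ) (rest : List ℕ)
  (conductor : IsConductor S c)
  (minimal : IsMinimalGeneratorList S (suc μ' ∷ a₂ ∷ rest))
  (a₂-large : c + suc μ' < 3 * a₂) where

  μ s : ℕ
  μ = suc μ'
  s = c + μ

  G : List ℕ
  G = a₂ ∷ rest

  P₁ P₂ : List ℕ
  P₁ = filter (inP₁? μ s) (μ ∷ G)
  P₂ = filter (inP₂? μ s) (μ ∷ G)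

  T : List ℕ
  T = G ++ (pairSums P₁ ++ cartesianProductWith _+_ P₁ P₂)

  large : ∀ {a} → a ∈ G → s < 3 * a
  large a∈ = <-≤-trans a₂-large (*-monoʳ-≤ 3 (proj₂ (increasing-bounds (proj₁ minimal) a∈)))

  ≢μ : ∀ {a} → a ∈ G → ¬ (a ≡ μ)
  ≢μ a∈ a≡μ = <⇒≢ (proj₁ (increasing-bounds (proj₁ minimal) a∈)) (sym a≡μ)

  in-P₁ : ∀ {a} → a ∈ G → 2 * a < s → a ∈ P₁
  in-P₁ a∈ 2a<s = ∈-filter⁺ (inP₁? μ s) {xs = μ ∷ G} (there a∈) (≢μ a∈ , large a∈ , 2a<s)

  in-P₂ : ∀ {a} → a ∈ G → s ≤ 2 * a → 3 * a < 2 * s → a ∈ P₂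
  in-P₂ a∈ s≤2a 3a<2s = ∈-filter⁺ (inP₂? μ s) {xs = μ ∷ G} (there a∈) (≢μ a∈ , s≤2a , 3a<2s)

  short-in-T : ∀ {z} → OneOrTwo G z → z < s → z ∈ T
  short-in-T (one a∈) _ = ∈-++⁺ˡ a∈
  short-in-T (two {a} {b} a∈ b∈ a≤b) a+b<s with 2 * b <? s
  ... | yes 2b<s = ∈-++⁺ʳ G (∈-++⁺ˡ (∈-pairSums P₁ a∈P₁ (in-P₁ b∈ 2b<s)))
    where a∈P₁ = in-P₁ a∈ (smaller-summand {s} a≤b a+b<s)
  ... | no 2b≮s = ∈-++⁺ʳ G (∈-++⁺ʳ (pairSums P₁) (∈-cartesianProductWith⁺ _+_ a∈P₁ b∈P₂))
    where
    a∈P₁ = in-P₁ a∈ (smaller-summand {s} a≤b a+b<s)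
    b∈P₂ = in-P₂ b∈ (≮⇒≥ 2b≮s) (other-summand {s} {a} {b} (large a∈) a+b<s)

  residue-in-T : ∀ r → 0 < r → r < μ → ∃[ y ] (y ∈ T × y % μ ≡ r)
  residue-in-T r 0<r r<μ with window-representative c μ (r + c * μ) c≤x
    where c≤x = ≤-trans (m≤m*n c μ) (m≤n+m (c * μ) r)
  ... | y , c≤y , y<s , y≡x with split-multiple (Equivalence.to (proj₁ (proj₂ minimal) y) y∈S)
    where y∈S = proj₁ conductor y c≤y
  ... | z , k , gz , refl = z , short-in-T (short-sum large gz z<s z≢0) z<s , z%μ≡r
    where
    z%μ≡r : z % μ ≡ r
    z%μ≡r = begin
      z % μ             ≡⟨ [m+kn]%n≡m%n z k μ ⟨
      (z + k * μ) % μ   ≡⟨ y≡x ⟩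
      (r + c * μ) % μ   ≡⟨ [m+kn]%n≡m%n r c μ ⟩
      r % μ             ≡⟨ m<n⇒m%n≡m r<μ ⟩
      r                 ∎
      where open ≡-Reasoning
    z<s : z < s
    z<s = ≤-<-trans (m≤m+n z (k * μ)) y<s
    z≢0 : z ≢ 0
    z≢0 z≡0 = <⇒≢ 0<r (trans (sym (cong (_% μ) z≡0)) z%μ≡r)

  -- Part (a): μ - 1 ≤ |T| = (ν - 1) + q₁(q₁+1)/2 + q₁q₂, doubled.
  multiplicity-bound : 2 * μ ≤ 2 * length (μ ∷ G) + length P₁ * (length P₁ + 1)
                                + 2 * (length P₁ * length P₂)
  multiplicity-bound = begin
    2 * suc μ'
      ≤⟨ *-monoʳ-≤ 2 (s≤s (nonzero-residues-bound μ' T residue-in-T)) ⟩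
    2 * suc (length T)
      ≡⟨ cong (λ t → 2 * suc t)
           (trans (length-++ G) (cong (λ t → length G + t) (length-++ (pairSums P₁)))) ⟩
    2 * suc (length G + (length (pairSums P₁) + length (cartesianProductWith _+_ P₁ P₂)))
      ≡⟨ regroup (length G) (length (pairSums P₁)) (length (cartesianProductWith _+_ P₁ P₂)) ⟩
    2 * suc (length G) + 2 * length (pairSums P₁)
      + 2 * length (cartesianProductWith _+_ P₁ P₂)
      ≡⟨ cong₂ (λ u v → 2 * suc (length G) + u + 2 * v)
           (length-pairSums P₁) (length-cartesianProductWith _+_ P₁ P₂) ⟩
    2 * suc (length G) + length P₁ * (length P₁ + 1) + 2 * (length P₁ * length P₂) ∎
    where
    open ≤-Reasoning
    regroup : ∀ g t p → 2 * suc (g + (t + p)) ≡ 2 * suc g + 2 * t + 2 * p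
    regroup = solve-∀

part-a : (S : NumericalSemigroup) (c μ a₂ : ℕ) (rest : List ℕ) →
  IsConductor S c → IsMinimalGeneratorList S (μ ∷ a₂ ∷ rest) → c + μ < 3 * a₂ →
  let Q₁ = q₁ μ (c + μ) (μ ∷ a₂ ∷ rest)
      Q₂ = q₂ μ (c + μ) (μ ∷ a₂ ∷ rest)
  in 2 * μ ≤ 2 * length (μ ∷ a₂ ∷ rest) + Q₁ * (Q₁ + 1) + 2 * (Q₁ * Q₂)
part-a S c zero     a₂ rest conductor minimal a₂-large = z≤n
part-a S c (suc μ') a₂ rest conductor minimal a₂-large =
  ResidueCovering.multiplicity-bound S c μ' a₂ rest conductor minimal a₂-large

-- P₁ and P₂ are disjoint and exclude μ, so q₁ + q₂ ≤ ν - 1.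
q₁+q₂<ν : ∀ μ s G → q₁ μ s (μ ∷ G) + q₂ μ s (μ ∷ G) < length (μ ∷ G)
q₁+q₂<ν μ s G = s≤s (begin
  q₁ μ s (μ ∷ G) + q₂ μ s (μ ∷ G)
    ≡⟨ cong₂ (λ u v → length u + length v)
         (filter-reject (inP₁? μ s) (λ p → proj₁ p refl))
         (filter-reject (inP₂? μ s) (λ p → proj₁ p refl)) ⟩
  length (filter (inP₁? μ s) G) + length (filter (inP₂? μ s) G)
    ≤⟨ length-filter-disjoint (inP₁? μ s) (inP₂? μ s)
         (λ p q → <⇒≱ (proj₂ (proj₂ p)) (proj₁ (proj₂ q))) G ⟩
  length G ∎)
  where open ≤-Reasoning

aBound : ℕ → ℕ → ℕ → ℕ
aBound ν Q₁ Q₂ = 2 * ν + Q₁ * (Q₁ + 1) + 2 * (Q₁ * Q₂)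

-- Writing ν = 1 + Q₁ + Q₂ + d, the bound (a) against ν(ν+1) and against
-- the discriminant (2ν+1)² leave explicit nonnegative slack.
aBound-slack-b : ∀ Q₁ Q₂ d →
  2 * suc (Q₁ + Q₂ + d) + Q₁ * (Q₁ + 1) + 2 * (Q₁ * Q₂)
    + (Q₂ * Q₂ + d * d + 2 * (Q₁ * d) + 2 * (Q₂ * d) + Q₂ + d)
    ≡ suc (Q₁ + Q₂ + d) * (suc (Q₁ + Q₂ + d) + 1)
aBound-slack-b = solve-∀

aBound-slack-c : ∀ Q₁ Q₂ d →
  (2 * Q₂ + 2 * d + 1) * (2 * Q₂ + 2 * d + 1)
    + 4 * (2 * suc (Q₁ + Q₂ + d) + Q₁ * (Q₁ + 1) + 2 * (Q₁ * Q₂)) + 8 * (Q₁ * d)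
    ≡ (2 * suc (Q₁ + Q₂ + d) + 1) * (2 * suc (Q₁ + Q₂ + d) + 1)
aBound-slack-c = solve-∀

minus-one-minus : ∀ A y B → A ≡ suc (y + B) → + A -ℤ + 1 -ℤ + B ≡ + y
minus-one-minus A y B refl = begin
  + A -ℤ + 1 -ℤ + B ≡⟨ cong (_-ℤ + B) (pos-minus (s≤s z≤n)) ⟩
  + (y + B) -ℤ + B  ≡⟨ pos-minus (m≤n+m B y) ⟩
  + (y + B ∸ B)     ≡⟨ cong +_ (m+n∸n≡m y B) ⟩
  + y               ∎
  where
  open ≡-Reasoning
  pos-minus : ∀ {m n} → n ≤ m → + m -ℤ + n ≡ + (m ∸ n)
  pos-minus {m} {n} n≤m = trans (ℤ.m-n≡m⊖n m n) (ℤ.⊖-≥ n≤m)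

-- Parts (b) and (c) follow from (a) and q₁ + q₂ < ν; in fact the quantity
-- k = 2ν - 1 - 2q₁ is always positive, so (c) holds in its squared form.
parts-b-c : ∀ ν Q₁ Q₂ μ → Q₁ + Q₂ < ν → 2 * μ ≤ aBound ν Q₁ Q₂ →
  let k = + (2 * ν) -ℤ + 1 -ℤ + (2 * Q₁)
  in (2 * μ ≤ ν * (ν + 1))
     × ((k ≤ℤ + 0) ⊎ (k *ℤ k +ℤ + (8 * μ) ≤ℤ + ((2 * ν + 1) * (2 * ν + 1))))
parts-b-c ν Q₁ Q₂ μ Q₁+Q₂<ν 2μ≤a with m≤n⇒∃[o]m+o≡n Q₁+Q₂<ν
... | d , refl = part-b , inj₂ part-c
  where
  ν′ = suc (Q₁ + Q₂ + d)
  y  = 2 * Q₂ + 2 * d + 1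

  part-b : 2 * μ ≤ ν′ * (ν′ + 1)
  part-b = ≤-trans 2μ≤a (subst (aBound ν′ Q₁ Q₂ ≤_) (aBound-slack-b Q₁ Q₂ d) (m≤m+n _ _))

  discriminant : y * y + 8 * μ ≤ (2 * ν′ + 1) * (2 * ν′ + 1)
  discriminant = begin
    y * y + 8 * μ                                ≡⟨ cong (λ t → y * y + t) (*-assoc 4 2 μ) ⟩
    y * y + 4 * (2 * μ)                          ≤⟨ +-monoʳ-≤ (y * y) (*-monoʳ-≤ 4 2μ≤a) ⟩
    y * y + 4 * aBound ν′ Q₁ Q₂                  ≤⟨ m≤m+n _ (8 * (Q₁ * d)) ⟩
    y * y + 4 * aBound ν′ Q₁ Q₂ + 8 * (Q₁ * d)   ≡⟨ aBound-slack-c Q₁ Q₂ d ⟩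
    (2 * ν′ + 1) * (2 * ν′ + 1)                  ∎
    where open ≤-Reasoning

  k≡y : + (2 * ν′) -ℤ + 1 -ℤ + (2 * Q₁) ≡ + y
  k≡y = minus-one-minus (2 * ν′) y (2 * Q₁) (double-ν Q₁ Q₂ d)
    where
    double-ν : ∀ Q₁ Q₂ d → 2 * suc (Q₁ + Q₂ + d) ≡ suc ((2 * Q₂ + 2 * d + 1) + 2 * Q₁)
    double-ν = solve-∀

  part-c : let k = + (2 * ν′) -ℤ + 1 -ℤ + (2 * Q₁) in
    k *ℤ k +ℤ + (8 * μ) ≤ℤ + ((2 * ν′ + 1) * (2 * ν′ + 1))
  part-c rewrite k≡y | sym (ℤ.pos-* y y) | sym (ℤ.pos-+ (y * y) (8 * μ)) =
    +≤+ discriminant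

proposition2p2 : (S : NumericalSemigroup) (c μ a₂ : ℕ) (rest : List ℕ) →
    IsConductor S c →
    IsMinimalGeneratorList S (μ ∷ a₂ ∷ rest) →
    c + μ < 3 * a₂ →
    let ν = length (μ ∷ a₂ ∷ rest)
        Q₁ = q₁ μ (c + μ) (μ ∷ a₂ ∷ rest)
        Q₂ = q₂ μ (c + μ) (μ ∷ a₂ ∷ rest)
        k = + (2 * ν) -ℤ + 1 -ℤ + (2 * Q₁)
    in (2 * μ ≤ 2 * ν + Q₁ * (Q₁ + 1) + 2 * (Q₁ * Q₂))
       × (2 * μ ≤ ν * (ν + 1))
       × ((k ≤ℤ + 0) ⊎ (k *ℤ k +ℤ + (8 * μ) ≤ℤ + ((2 * ν + 1) * (2 * ν + 1))))
proposition2p2 S c μ a₂ rest conductor minimal a₂-large =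
  bound-a , parts-b-c (length (μ ∷ a₂ ∷ rest)) (q₁ μ (c + μ) (μ ∷ a₂ ∷ rest))
                      (q₂ μ (c + μ) (μ ∷ a₂ ∷ rest)) μ
                      (q₁+q₂<ν μ (c + μ) (a₂ ∷ rest)) bound-a
  where
  bound-a = part-a S c μ a₂ rest conductor minimal a₂-large
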